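{- Let $D$ be a simple digraph with $n$ vertices and $\overline{D}$ its complement. Then (i) $\displaystyle f_{A(\overline{D})}(\lambda) = (-1)^n\big(1 + \chi_{A(D)}(-\lambda - 1)\big)\, f_{A(D)}(-\lambda - 1)$, (ii) $\displaystyle f_{L(\overline{D})}(\lambda)=(-1)^n\frac{\lambda}{\lambda-n}f_{L(D)}(n-\lambda)$, (iii) $\displaystyle f_{Q(\overline{D})}(\lambda) = (-1)^n\big(1 + \chi_{Q(D)}(n-\lambda-2)\big)\, f_{Q(D)}(n-\lambda-2)$.
   Context: Digraphs are simple (no loops, no multiple arcs). For a digraph $D$ with vertices $v_1,\dots,v_n$, $A(D)$ is the adjacency matrix ($a_{ij}=1$ if $v_iv_j$ is an arc, $0$ otherwise), $D_{\rm out}(D)$ the diagonal out-degree matrix, $L(D)=D_{\rm out}(D)-A(D)$ the Laplacian and $Q(D)=D_{\rm out}(D)+A(D)$ the signless Laplacian. The complement $\overline{D}$ has the same vertex set and, for $u\ne v$, $uv$ is an arc of $\overline{D}$ iff it is not an arc of $D$. For a square matrix $M$, $f_M(\lambda)=\det(\lambda I-M)$. For a real $n\times n$ matrix $M$ regarded over $\mathbb{C}(\lambda)$, the $M$-coronal is $\chi_M(\lambda)=\mathbf{1}_n^T(\lambda I_n-M)^{ -1}\mathbf{1}_n$, with $\mathbf{1}_n$ the all-ones column vector. -}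

module Defs where

open import Data.Nat using (ℕ; zero; suc)
open import Data.Fin using (Fin; zero; suc; punchIn; _≟_)
open import Data.Bool using (Bool; true; false; not; if_then_else_)
open import Data.Rational using (ℚ; 0ℚ; 1ℚ; _+_; _*_; _-_; -_)
open import Relation.Binary.PropositionalEquality using (_≡_)
open import Relation.Nullary using (does)

Mat : ℕ → Set
Mat n = Fin n → Fin n → ℚ

Σ : ∀ {n} → (Fin n → ℚ) → ℚ
Σ {zero}  f = 0ℚ
Σ {suc n} f = f zero + Σ (λ i → f (suc i))

sgn : ℕ → ℚ
sgn zero    = 1ℚ
sgn (suc k) = - sgn k

det : ∀ {n} → Mat n → ℚ
det {zero}  M = 1ℚ
det {suc n} M =
  Σ (λ j → sgn (Data.Fin.toℕ j) * (M zero j * det (λ i k → M (suc i) (punchIn j k))))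

I : ∀ {n} → Mat n
I i j = if does (i ≟ j) then 1ℚ else 0ℚ

_⊗_ : ∀ {n} → Mat n → Mat n → Mat n
(M ⊗ N) i j = Σ (λ k → M i k * N k j)

_⊕_ : ∀ {n} → Mat n → Mat n → Mat n
(M ⊕ N) i j = M i j + N i j

_⊖_ : ∀ {n} → Mat n → Mat n → Mat n
(M ⊖ N) i j = M i j - N i j

_·I : ∀ {n} → ℚ → Mat n
(c ·I) i j = c * I i j

charPoly : ∀ {n} → Mat n → ℚ → ℚ
charPoly M x = det ((x ·I) ⊖ M)

IsInverse : ∀ {n} → Mat n → Mat n → Set
IsInverse {n} B M = (∀ i j → (B ⊗ M) i j ≡ I i j) × (∀ i j → (M ⊗ B) i j ≡ I i j)
  where open import Data.Product using (_×_)

onesForm : ∀ {n} → Mat n → ℚ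
onesForm B = Σ (λ i → Σ (λ j → B i j))

-- simple digraphs on vertex set Fin n (no loops; no multiple arcs by construction)
record Digraph (n : ℕ) : Set where
  field
    arc     : Fin n → Fin n → Bool
    loopless : ∀ i → arc i i ≡ false
open Digraph public

b2q : Bool → ℚ
b2q true  = 1ℚ
b2q false = 0ℚ

complement : ∀ {n} → Digraph n → Digraph n
complement {n} D = record { arc = a ; loopless = lp }
  where
  a : Fin n → Fin n → Bool
  a i j = if does (i ≟ j) then false else not (arc D i j)
  lp : ∀ i → a i i ≡ false
  lp i with i ≟ i
  ... | Relation.Nullary.yes _ = Relation.Binary.PropositionalEquality.refl
  ... | Relation.Nullary.no ¬p = Data.Empty.⊥-elim (¬p Relation.Binary.PropositionalEquality.refl)
    where import Data.Empty

adjMat : ∀ {n} → Digraph n → Mat n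
adjMat D i j = b2q (arc D i j)

outDegMat : ∀ {n} → Digraph n → Mat n
outDegMat D i j = if does (i ≟ j) then Σ (λ k → b2q (arc D i k)) else 0ℚ

lapMat : ∀ {n} → Digraph n → Mat n
lapMat D = outDegMat D ⊖ adjMat D

signlessLapMat : ∀ {n} → Digraph n → Mat n
signlessLapMat D = outDegMat D ⊕ adjMat D

ℕ→ℚ : ℕ → ℚ
ℕ→ℚ k = Data.Rational._/_ (Data.Integer.+ k) 1
  where import Data.Integer

-- The complement satisfies A(D̄) = J − I − A(D) and D_out(D̄) = (n − 1) I − D_out(D), J the
-- all-ones matrix. Hence λI − M(D̄) = −(N + J) for M = A, Q and λI − L(D̄) = −(N − J), where
-- N = μI − M(D) at the shifted argument μ of the statement. Negation contributes (−1)ⁿ, and adding J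
-- is a rank-one update handled by the matrix determinant lemma: if 𝟏ᵀ = yᵀN then
-- det (N + J) = (1 + yᵀ𝟏) det N. For A and Q take yᵀ = 𝟏ᵀB with B = N⁻¹, so that yᵀ𝟏 = 𝟏ᵀB𝟏 is
-- the coronal. For L every row of N sums to n − λ, so after transposing, y = 𝟏 / (λ − n) applies
-- to −J and gives the factor 1 + n / (λ − n) = λ / (λ − n).

module Submission where

open import Defs
open import Algebra.Bundles using (CommutativeRing)
open import Data.Bool using (true; false; if_then_else_)
open import Data.Fin using (Fin; zero; suc; punchIn; toℕ; _≟_)
open import Data.Fin.Properties using (suc-injective)
import Data.Integer as ℤ
import Data.Integer.Properties as ℤ
open import Data.Nat using (ℕ; zero; suc)
import Data.Nat.Coprimality as Coprime
open import Data.Product using (_×_; _,_)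
open import Data.Rational using (ℚ; 0ℚ; 1ℚ; _+_; _*_; _-_; -_; _÷_; 1/_; ≢-nonZero)
import Data.Rational.Properties as ℚ
open import Data.Vec.Functional using (updateAt; tail)
open import Data.Vec.Functional.Properties
  using (map-updateAt; updateAt-updates; updateAt-minimal; updateAt-commutes; updateAt-id-local)
open import Function using (_∘_; const)
open import Relation.Binary.PropositionalEquality
  using (_≡_; _≢_; refl; sym; trans; cong; cong₂; cong-app; module ≡-Reasoning)
open import Relation.Nullary using (yes; no; contradiction)
open import Relation.Nullary.Decidable using (dec-true; dec-false)
import Relation.Nullary.Decidable.Core as Dec
open import Tactic.RingSolver using (solve-∀)
open import Tactic.RingSolver.Core.AlmostCommutativeRing using (AlmostCommutativeRing; fromCommutativeRing)

open CommutativeRing ℚ.+-*-commutativeRing using (semiring)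
open import Algebra.Properties.Semiring.Sum semiring
  using (sum; sum-cong-≗; ∑-distrib-+; ∑-comm; *-distribˡ-sum; *-distribʳ-sum; sum-replicate-zero)
open ≡-Reasoning

ℚ-ring : AlmostCommutativeRing _ _
ℚ-ring = fromCommutativeRing ℚ.+-*-commutativeRing (λ x → Dec.dec⇒maybe (0ℚ ℚ.≟ x))

Σ≡sum : ∀ {n} (f : Fin n → ℚ) → Σ f ≡ sum f
Σ≡sum {zero}  f = refl
Σ≡sum {suc n} f = cong (f zero +_) (Σ≡sum (f ∘ suc))

Σ-cong : ∀ {n} {f g : Fin n → ℚ} → (∀ i → f i ≡ g i) → Σ f ≡ Σ g
Σ-cong {f = f} {g} f≗g = trans (Σ≡sum f) (trans (sum-cong-≗ f≗g) (sym (Σ≡sum g)))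

Σ-distrib-+ : ∀ {n} (f g : Fin n → ℚ) → Σ (λ i → f i + g i) ≡ Σ f + Σ g
Σ-distrib-+ f g =
  trans (Σ≡sum (λ i → f i + g i)) (trans (∑-distrib-+ f g) (sym (cong₂ _+_ (Σ≡sum f) (Σ≡sum g))))

*-distribˡ-Σ : ∀ {n} c (f : Fin n → ℚ) → c * Σ f ≡ Σ (λ i → c * f i)
*-distribˡ-Σ c f =
  trans (cong (c *_) (Σ≡sum f)) (trans (*-distribˡ-sum c f) (sym (Σ≡sum (λ i → c * f i))))

*-distribʳ-Σ : ∀ {n} c (f : Fin n → ℚ) → Σ f * c ≡ Σ (λ i → f i * c)
*-distribʳ-Σ c f =
  trans (cong (_* c) (Σ≡sum f)) (trans (*-distribʳ-sum c f) (sym (Σ≡sum (λ i → f i * c))))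

*-distribˡ-Σ² : ∀ {n} s a (f : Fin n → ℚ) → s * (a * Σ f) ≡ Σ (λ i → s * (a * f i))
*-distribˡ-Σ² s a f = trans (cong (s *_) (*-distribˡ-Σ a f)) (*-distribˡ-Σ s (λ i → a * f i))

Σ-zero : ∀ {n} {f : Fin n → ℚ} → (∀ i → f i ≡ 0ℚ) → Σ f ≡ 0ℚ
Σ-zero {n} f≗0 = trans (Σ-cong f≗0) (trans (Σ≡sum {n} (λ _ → 0ℚ)) (sum-replicate-zero n))

Σ-comm : ∀ {m n} (f : Fin m → Fin n → ℚ) → Σ (λ i → Σ (f i)) ≡ Σ (λ j → Σ (λ i → f i j))
Σ-comm f = begin
  Σ (λ i → Σ (f i))             ≡⟨ Σ²≡sum² f ⟩
  sum (λ i → sum (f i))         ≡⟨ ∑-comm f ⟩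
  sum (λ j → sum (λ i → f i j)) ≡⟨ Σ²≡sum² (λ j i → f i j) ⟨
  Σ (λ j → Σ (λ i → f i j))     ∎
  where
  Σ²≡sum² : ∀ {m n} (g : Fin m → Fin n → ℚ) → Σ (λ i → Σ (g i)) ≡ sum (λ i → sum (g i))
  Σ²≡sum² g = trans (Σ≡sum (λ i → Σ (g i))) (sum-cong-≗ (λ i → Σ≡sum (g i)))

Σ-distrib-- : ∀ {n} (f g : Fin n → ℚ) → Σ (λ i → f i - g i) ≡ Σ f - Σ g
Σ-distrib-- {zero}  f g = refl
Σ-distrib-- {suc n} f g = begin
  (f zero - g zero) + Σ (λ i → f (suc i) - g (suc i))
    ≡⟨ cong ((f zero - g zero) +_) (Σ-distrib-- (f ∘ suc) (g ∘ suc)) ⟩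
  (f zero - g zero) + (Σ (f ∘ suc) - Σ (g ∘ suc))
    ≡⟨ regroup (f zero) (g zero) (Σ (f ∘ suc)) (Σ (g ∘ suc)) ⟩
  (f zero + Σ (f ∘ suc)) - (g zero + Σ (g ∘ suc)) ∎
  where
  regroup : ∀ a b c d → (a - b) + (c - d) ≡ (a + c) - (b + d)
  regroup = solve-∀ ℚ-ring

Σ-linear : ∀ {n} {f g h : Fin n → ℚ} c → (∀ i → f i ≡ c * g i + h i) → Σ f ≡ c * Σ g + Σ h
Σ-linear {f = f} {g} {h} c f≗cg+h = begin
  Σ f                               ≡⟨ Σ-cong f≗cg+h ⟩
  Σ (λ i → c * g i + h i)           ≡⟨ Σ-distrib-+ (λ i → c * g i) h ⟩
  Σ (λ i → c * g i) + Σ h           ≡⟨ cong (_+ Σ h) (*-distribˡ-Σ c g) ⟨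
  c * Σ g + Σ h                     ∎

Σ-select : ∀ {n} (f : Fin n → ℚ) t → (∀ i → i ≢ t → f i ≡ 0ℚ) → Σ f ≡ f t
Σ-select {suc n} f zero f≗0 = begin
  f zero + Σ (f ∘ suc) ≡⟨ cong (f zero +_) (Σ-zero (λ i → f≗0 (suc i) (λ ()))) ⟩
  f zero + 0ℚ          ≡⟨ ℚ.+-identityʳ (f zero) ⟩
  f zero               ∎
Σ-select {suc n} f (suc t) f≗0 = begin
  f zero + Σ (f ∘ suc)
    ≡⟨ cong₂ _+_ (f≗0 zero (λ ())) (Σ-select (f ∘ suc) t (λ i i≢t → f≗0 (suc i) (i≢t ∘ suc-injective))) ⟩
  0ℚ + f (suc t)       ≡⟨ ℚ.+-identityˡ (f (suc t)) ⟩
  f (suc t)            ∎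

ℕ→ℚ-suc : ∀ k → ℕ→ℚ (suc k) ≡ 1ℚ + ℕ→ℚ k
ℕ→ℚ-suc k rewrite ℚ.normalize-coprime (Coprime.sym (Coprime.1-coprimeTo k)) | ℤ.*-identityʳ (ℤ.+ k) = refl

Σ-const : ∀ {n} c → Σ {n} (λ _ → c) ≡ c * ℕ→ℚ n
Σ-const {zero}  c = sym (ℚ.*-zeroʳ c)
Σ-const {suc n} c = begin
  c + Σ {n} (λ _ → c)  ≡⟨ cong (c +_) (Σ-const {n} c) ⟩
  c + c * ℕ→ℚ n        ≡⟨ factor c (ℕ→ℚ n) ⟩
  c * (1ℚ + ℕ→ℚ n)     ≡⟨ cong (c *_) (ℕ→ℚ-suc n) ⟨
  c * ℕ→ℚ (suc n)      ∎
  where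
  factor : ∀ c m → c + c * m ≡ c * (1ℚ + m)
  factor = solve-∀ ℚ-ring

I-diag : ∀ {n} (i : Fin n) → I i i ≡ 1ℚ
I-diag i = cong (if_then 1ℚ else 0ℚ) (dec-true (i ≟ i) refl)

I-offDiag : ∀ {n} {i j : Fin n} → i ≢ j → I i j ≡ 0ℚ
I-offDiag {i = i} {j} i≢j = cong (if_then 1ℚ else 0ℚ) (dec-false (i ≟ j) i≢j)

Σ-I-row : ∀ {n} (i : Fin n) → Σ (I i) ≡ 1ℚ
Σ-I-row i = trans (Σ-select (I i) i (λ j j≢i → I-offDiag (j≢i ∘ sym))) (I-diag i)

Σ-I-column : ∀ {n} (j : Fin n) → Σ (λ i → I i j) ≡ 1ℚ
Σ-I-column j = trans (Σ-select (λ i → I i j) j (λ i → I-offDiag)) (I-diag j)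

-- Determinants: cofactor expansion and multilinearity

sign : ∀ {n} → Fin n → ℚ
sign j = sgn (toℕ j)

minor : ∀ {n} → Mat (suc n) → Fin (suc n) → Mat n
minor M j i k = M (suc i) (punchIn j k)

infixl 6 _[_]≔_
_[_]≔_ : ∀ {n} → Mat n → Fin n → (Fin n → ℚ) → Mat n
M [ r ]≔ u = updateAt M r (const u)

det-cong : ∀ {n} {M N : Mat n} → (∀ i j → M i j ≡ N i j) → det M ≡ det N
det-cong {zero}  M≈N = refl
det-cong {suc n} M≈N =
  Σ-cong (λ j → cong₂ (λ a d → sign j * (a * d)) (M≈N zero j) (det-cong (λ i k → M≈N (suc i) (punchIn j k))))

det-cong-rows : ∀ {n} {M N : Mat n} → (∀ i → M i ≡ N i) → det M ≡ det N
det-cong-rows M≗N = det-cong (λ i → cong-app (M≗N i))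

minor-[suc]≔ : ∀ {n} (M : Mat (suc n)) r u j i → minor (M [ suc r ]≔ u) j i ≡ (minor M j [ r ]≔ (u ∘ punchIn j)) i
minor-[suc]≔ M r u j = map-updateAt {f = _∘ punchIn j} {g = const u} (λ _ → refl) (tail M) r

det-[suc]≔ : ∀ {n} (M : Mat (suc n)) r u →
  det (M [ suc r ]≔ u) ≡ Σ (λ j → sign j * (M zero j * det (minor M j [ r ]≔ (u ∘ punchIn j))))
det-[suc]≔ M r u = Σ-cong (λ j → cong (λ d → sign j * (M zero j * d)) (det-cong-rows (minor-[suc]≔ M r u j)))

det-[]≔-linear : ∀ {n} (M : Mat n) r c (u v : Fin n → ℚ) →
  det (M [ r ]≔ (λ j → c * u j + v j)) ≡ c * det (M [ r ]≔ u) + det (M [ r ]≔ v)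
det-[]≔-linear {suc n} M zero c u v = Σ-linear c (λ j → expand c (sign j) (u j) (v j) (det (minor M j)))
  where
  expand : ∀ c s a b d → s * ((c * a + b) * d) ≡ c * (s * (a * d)) + s * (b * d)
  expand = solve-∀ ℚ-ring
det-[]≔-linear {suc n} M (suc r) c u v = begin
  det (M [ suc r ]≔ w)
    ≡⟨ det-[suc]≔ M r w ⟩
  Σ (λ j → sign j * (M zero j * det (minor M j [ r ]≔ (w ∘ punchIn j))))
    ≡⟨ Σ-linear c (λ j → trans (cong (λ d → sign j * (M zero j * d))
                                     (det-[]≔-linear (minor M j) r c (u ∘ punchIn j) (v ∘ punchIn j)))
                               (expand c (sign j) (M zero j) _ _)) ⟩
  c * Σ (λ j → sign j * (M zero j * det (minor M j [ r ]≔ (u ∘ punchIn j))))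
    + Σ (λ j → sign j * (M zero j * det (minor M j [ r ]≔ (v ∘ punchIn j))))
    ≡⟨ cong₂ (λ a b → c * a + b) (det-[suc]≔ M r u) (det-[suc]≔ M r v) ⟨
  c * det (M [ suc r ]≔ u) + det (M [ suc r ]≔ v) ∎
  where
  w = λ j → c * u j + v j
  expand : ∀ c s a x y → s * (a * (c * x + y)) ≡ c * (s * (a * x)) + s * (a * y)
  expand = solve-∀ ℚ-ring

det-[]≔-zero : ∀ {n} (M : Mat n) r → det (M [ r ]≔ (λ _ → 0ℚ)) ≡ 0ℚ
det-[]≔-zero M r = idempotent⇒zero (det-[]≔-linear M r 1ℚ (λ _ → 0ℚ) (λ _ → 0ℚ))
  where
  idempotent⇒zero : ∀ {d} → d ≡ 1ℚ * d + d → d ≡ 0ℚ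
  idempotent⇒zero {d} d≡d+d = begin
    d                   ≡⟨ cancel d ⟩
    (1ℚ * d + d) - d    ≡⟨ cong (_- d) d≡d+d ⟨
    d - d               ≡⟨ ℚ.+-inverseʳ d ⟩
    0ℚ                  ∎
    where
    cancel : ∀ d → d ≡ (1ℚ * d + d) - d
    cancel = solve-∀ ℚ-ring

det-[]≔-linear-Σ : ∀ {n m} (M : Mat n) r (c : Fin m → ℚ) (V : Fin m → Fin n → ℚ) →
  det (M [ r ]≔ (λ j → Σ (λ k → c k * V k j))) ≡ Σ (λ k → c k * det (M [ r ]≔ V k))
det-[]≔-linear-Σ {m = zero}  M r c V = det-[]≔-zero M r
det-[]≔-linear-Σ {m = suc m} M r c V =
  trans (det-[]≔-linear M r (c zero) (V zero) (λ j → Σ (λ k → c (suc k) * V (suc k) j)))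
        (cong (c zero * det (M [ r ]≔ V zero) +_) (det-[]≔-linear-Σ M r (c ∘ suc) (V ∘ suc)))

-- Determinants: alternation

-- punchBack j k is the position of j among the indices other than punchIn j k, so
-- (j , k) ↦ (punchIn j k , punchBack j k) is a fixed-point-free involution.
punchBack : ∀ {m} → Fin (suc (suc m)) → Fin (suc m) → Fin (suc m)
punchBack zero    k       = zero
punchBack (suc j) zero    = j
punchBack {suc m} (suc j) (suc k) = suc (punchBack j k)

punchIn-punchBack : ∀ {m} (j : Fin (suc (suc m))) k → punchIn (punchIn j k) (punchBack j k) ≡ j
punchIn-punchBack zero    k       = refl
punchIn-punchBack (suc j) zero    = refl
punchIn-punchBack {suc m} (suc j) (suc k) = cong suc (punchIn-punchBack j k)

punchIn-punchIn-punchBack : ∀ {m} (j : Fin (suc (suc m))) k l →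
  punchIn (punchIn j k) (punchIn (punchBack j k) l) ≡ punchIn j (punchIn k l)
punchIn-punchIn-punchBack zero    k       l       = refl
punchIn-punchIn-punchBack (suc j) zero    l       = refl
punchIn-punchIn-punchBack {suc m} (suc j) (suc k) zero    = refl
punchIn-punchIn-punchBack {suc m} (suc j) (suc k) (suc l) = cong suc (punchIn-punchIn-punchBack j k l)

sign-punchBack : ∀ {m} (j : Fin (suc (suc m))) k →
  sign j * sign k ≡ - (sign (punchIn j k) * sign (punchBack j k))
sign-punchBack zero    k       = flip (sign k)
  where
  flip : ∀ s → 1ℚ * s ≡ - ((- s) * 1ℚ)
  flip = solve-∀ ℚ-ring
sign-punchBack (suc j) zero    = flip (sign j)
  where
  flip : ∀ s → (- s) * 1ℚ ≡ - (1ℚ * s)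
  flip = solve-∀ ℚ-ring
sign-punchBack {suc m} (suc j) (suc k) = begin
  (- sign j) * (- sign k)                                ≡⟨ neg*neg (sign j) (sign k) ⟩
  sign j * sign k                                        ≡⟨ sign-punchBack j k ⟩
  - (sign (punchIn j k) * sign (punchBack j k))
    ≡⟨ cong -_ (neg*neg (sign (punchIn j k)) (sign (punchBack j k))) ⟨
  - ((- sign (punchIn j k)) * (- sign (punchBack j k)))  ∎
  where
  neg*neg : ∀ a b → (- a) * (- b) ≡ a * b
  neg*neg = solve-∀ ℚ-ring

Σ²-cancel-step : ∀ {m} (G : Fin (suc (suc m)) → Fin (suc m) → ℚ) →
  (∀ j k → G j k + G (punchIn j k) (punchBack j k) ≡ 0ℚ) →
  Σ (λ j → Σ (λ k → G (suc j) (suc k))) ≡ 0ℚ → Σ (λ j → Σ (G j)) ≡ 0ℚ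
Σ²-cancel-step G cancels inner≡0 = begin
  Σ (G zero) + Σ (λ j → G (suc j) zero + R j)
    ≡⟨ cong (Σ (G zero) +_) (Σ-distrib-+ (λ j → G (suc j) zero) R) ⟩
  Σ (G zero) + (Σ (λ j → G (suc j) zero) + Σ R)
    ≡⟨ ℚ.+-assoc (Σ (G zero)) _ _ ⟨
  (Σ (G zero) + Σ (λ j → G (suc j) zero)) + Σ R
    ≡⟨ cong₂ _+_ (trans (sym (Σ-distrib-+ (G zero) (λ j → G (suc j) zero))) (Σ-zero (cancels zero))) inner≡0 ⟩
  0ℚ + 0ℚ
    ≡⟨⟩
  0ℚ ∎
  where
  R = λ j → Σ (λ k → G (suc j) (suc k))

Σ²-cancel : ∀ {m} (G : Fin (suc (suc m)) → Fin (suc m) → ℚ) →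
  (∀ j k → G j k + G (punchIn j k) (punchBack j k) ≡ 0ℚ) → Σ (λ j → Σ (G j)) ≡ 0ℚ
Σ²-cancel {zero}  G cancels = Σ²-cancel-step G cancels (Σ-zero {1} (λ _ → refl))
Σ²-cancel {suc m} G cancels =
  Σ²-cancel-step G cancels (Σ²-cancel (λ j k → G (suc j) (suc k)) (λ j k → cancels (suc j) (suc k)))

-- Expanding along the first two rows, the terms (j , k) and (punchIn j k , punchBack j k)
-- use the same two columns in opposite orders.
det-rows₀₁-equal : ∀ {m} (M : Mat (suc (suc m))) → M zero ≡ M (suc zero) → det M ≡ 0ℚ
det-rows₀₁-equal {m} M row₀≡row₁ = trans (Σ-cong expand) (Σ²-cancel G cancels)
  where
  D : Fin (suc (suc m)) → Fin (suc m) → ℚ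
  D j k = det (λ i l → M (suc (suc i)) (punchIn j (punchIn k l)))
  G : Fin (suc (suc m)) → Fin (suc m) → ℚ
  G j k = sign j * (M zero j * (sign k * (M (suc zero) (punchIn j k) * D j k)))
  expand : ∀ j → sign j * (M zero j * det (minor M j)) ≡ Σ (G j)
  expand j = trans (cong (sign j *_) (*-distribˡ-Σ (M zero j) F)) (*-distribˡ-Σ (sign j) (λ k → M zero j * F k))
    where
    F = λ k → sign k * (M (suc zero) (punchIn j k) * D j k)
  collect : ∀ sj sk sp sq x y d →
    sj * (x * (sk * (y * d))) + sp * (y * (sq * (x * d))) ≡ (sj * sk + sp * sq) * (x * y * d)
  collect = solve-∀ ℚ-ring
  cancels : ∀ j k → G j k + G (punchIn j k) (punchBack j k) ≡ 0ℚ
  cancels j k = begin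
    G j k + G p q
      ≡⟨ cong (G j k +_) partner ⟩
    sign j * (x * (sign k * (y * D j k))) + sign p * (y * (sign q * (x * D j k)))
      ≡⟨ collect (sign j) (sign k) (sign p) (sign q) x y (D j k) ⟩
    (sign j * sign k + sign p * sign q) * (x * y * D j k)
      ≡⟨ cong (λ s → (s + sign p * sign q) * (x * y * D j k)) (sign-punchBack j k) ⟩
    (- (sign p * sign q) + sign p * sign q) * (x * y * D j k)
      ≡⟨ cong (_* (x * y * D j k)) (ℚ.+-inverseˡ (sign p * sign q)) ⟩
    0ℚ * (x * y * D j k)
      ≡⟨ ℚ.*-zeroˡ (x * y * D j k) ⟩
    0ℚ ∎
    where
    p = punchIn j k
    q = punchBack j k
    x = M zero j
    y = M (suc zero) p
    partner : G p q ≡ sign p * (y * (sign q * (x * D j k)))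
    partner = cong₂ (λ a b → sign p * (a * (sign q * b)))
      (cong-app row₀≡row₁ p)
      (cong₂ _*_ (trans (cong (M (suc zero)) (punchIn-punchBack j k)) (sym (cong-app row₀≡row₁ j)))
                 (det-cong (λ i l → cong (M (suc (suc i))) (punchIn-punchIn-punchBack j k l))))

det-[]≔²-antisym : ∀ {n} (M : Mat n) {a b} → a ≢ b → (∀ X → X a ≡ X b → det X ≡ 0ℚ) →
  ∀ x y → det (M [ a ]≔ x [ b ]≔ y) + det (M [ a ]≔ y [ b ]≔ x) ≡ 0ℚ
det-[]≔²-antisym M {a} {b} a≢b alternating x y = begin
  f x y + f y x
    ≡⟨ pad (f x y) (f y x) ⟩
  1ℚ * (1ℚ * 0ℚ + f x y) + (1ℚ * f y x + 0ℚ)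
    ≡⟨ cong₂ (λ p q → 1ℚ * (1ℚ * p + f x y) + (1ℚ * f y x + q)) (f-diag x) (f-diag y) ⟨
  1ℚ * (1ℚ * f x x + f x y) + (1ℚ * f y x + f y y)
    ≡⟨ cong₂ (λ p q → 1ℚ * p + q) (linear₂ x) (linear₂ y) ⟨
  1ℚ * f x s + f y s
    ≡⟨ linear₁ s ⟨
  f s s
    ≡⟨ f-diag s ⟩
  0ℚ ∎
  where
  f : (Fin _ → ℚ) → (Fin _ → ℚ) → ℚ
  f x y = det (M [ a ]≔ x [ b ]≔ y)
  s = λ j → 1ℚ * x j + y j
  f-diag : ∀ w → f w w ≡ 0ℚ
  f-diag w = alternating (M [ a ]≔ w [ b ]≔ w)
    (trans (updateAt-minimal a b (M [ a ]≔ w) a≢b)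
           (trans (updateAt-updates a M) (sym (updateAt-updates b (M [ a ]≔ w)))))
  commute : ∀ x y → f x y ≡ det (M [ b ]≔ y [ a ]≔ x)
  commute x y = det-cong-rows (updateAt-commutes b a (a≢b ∘ sym) M)
  linear₁ : ∀ z → f s z ≡ 1ℚ * f x z + f y z
  linear₁ z = trans (commute s z)
    (trans (det-[]≔-linear (M [ b ]≔ z) a 1ℚ x y)
           (sym (cong₂ (λ p q → 1ℚ * p + q) (commute x z) (commute y z))))
  linear₂ : ∀ w → f w s ≡ 1ℚ * f w x + f w y
  linear₂ w = det-[]≔-linear (M [ a ]≔ w) b 1ℚ x y
  pad : ∀ p q → p + q ≡ 1ℚ * (1ℚ * 0ℚ + p) + (1ℚ * q + 0ℚ)
  pad = solve-∀ ℚ-ring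

mutual
  det-alternating : ∀ {n} (M : Mat n) {r s} → r ≢ s → M r ≡ M s → det M ≡ 0ℚ
  det-alternating {suc n} M {zero}  {zero}  r≢s _   = contradiction refl r≢s
  det-alternating {suc n} M {zero}  {suc s} _   r≡s = det-alternating-row₀ M s r≡s
  det-alternating {suc n} M {suc r} {zero}  _   r≡s = det-alternating-row₀ M r (sym r≡s)
  det-alternating {suc n} M {suc r} {suc s} r≢s r≡s = det-alternating-suc M (r≢s ∘ cong suc) r≡s

  det-alternating-suc : ∀ {n} (M : Mat (suc n)) {r s} → r ≢ s → M (suc r) ≡ M (suc s) → det M ≡ 0ℚ
  det-alternating-suc M r≢s r≡s = Σ-zero λ j →
    trans (cong (λ d → sign j * (M zero j * d)) (det-alternating (minor M j) r≢s (cong (_∘ punchIn j) r≡s)))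
          (annihilate (sign j) (M zero j))
    where
    annihilate : ∀ s a → s * (a * 0ℚ) ≡ 0ℚ
    annihilate = solve-∀ ℚ-ring

  -- Rows 0 and t + 2 are reduced to rows 0 and 1 by swapping rows 1 and t + 2; rows 0 and 1
  -- of swapped are M 0 and M (t + 2) by computation.
  det-alternating-row₀ : ∀ {n} (M : Mat (suc n)) t → M zero ≡ M (suc t) → det M ≡ 0ℚ
  det-alternating-row₀ {suc m} M zero    r≡s = det-rows₀₁-equal M r≡s
  det-alternating-row₀ {suc m} M (suc t) r≡s = begin
    det M
      ≡⟨ ℚ.+-identityʳ (det M) ⟨
    det M + 0ℚ
      ≡⟨ cong₂ _+_ (det-cong-rows unchanged) (det-rows₀₁-equal swapped r≡s) ⟨
    det (M [ a ]≔ M a [ b ]≔ M b) + det swapped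
      ≡⟨ det-[]≔²-antisym M {a} {b} (λ ()) (λ X → det-alternating-suc X {zero} {suc t} (λ ())) (M a) (M b) ⟩
    0ℚ ∎
    where
    a = suc zero
    b = suc (suc t)
    swapped = M [ a ]≔ M b [ b ]≔ M a
    unchanged : ∀ i → (M [ a ]≔ M a [ b ]≔ M b) i ≡ M i
    unchanged i = trans (updateAt-id-local b (M [ a ]≔ M a) refl i) (updateAt-id-local a M refl i)

-- Determinants: rank-one updates, negation and transposition

det-add-to-rows : ∀ {n} (N : Mat n) (u : Fin n → ℚ) →
  det (λ i j → N i j + u j) ≡ det N + Σ (λ i → det (N [ i ]≔ u))
det-add-to-rows {zero}  N u = sym (ℚ.+-identityʳ 1ℚ)
det-add-to-rows {suc n} N u = begin
  Σ (λ j → sign j * ((N zero j + u j) * det (λ i k → minor N j i k + u (punchIn j k))))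
    ≡⟨ Σ-cong (λ j → cong (λ d → sign j * ((N zero j + u j) * d)) (det-add-to-rows (minor N j) (u ∘ punchIn j))) ⟩
  Σ (λ j → sign j * ((N zero j + u j) * (det (minor N j) + E j)))
    ≡⟨ Σ-cong (λ j → expand (sign j) (N zero j) (u j) (det (minor N j)) (E j)) ⟩
  Σ (λ j → (A j + B j) + (C j + D j))
    ≡⟨ Σ-distrib-+ (λ j → A j + B j) (λ j → C j + D j) ⟩
  Σ (λ j → A j + B j) + Σ (λ j → C j + D j)
    ≡⟨ cong₂ _+_ (Σ-distrib-+ A B) (Σ-distrib-+ C D) ⟩
  (det N + det (N [ zero ]≔ u)) + (Σ C + Σ D)
    ≡⟨ cong₂ (λ c d → (det N + det (N [ zero ]≔ u)) + (c + d)) ΣC ΣD ⟩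
  (det N + det (N [ zero ]≔ u)) + (Σ (λ i → det (N [ suc i ]≔ u)) + 0ℚ)
    ≡⟨ regroup (det N) (det (N [ zero ]≔ u)) (Σ (λ i → det (N [ suc i ]≔ u))) ⟩
  det N + (det (N [ zero ]≔ u) + Σ (λ i → det (N [ suc i ]≔ u))) ∎
  where
  F : Fin (suc n) → Fin n → ℚ
  F j i = det (minor N j [ i ]≔ (u ∘ punchIn j))
  E A B C D : Fin (suc n) → ℚ
  E j = Σ (F j)
  A j = sign j * (N zero j * det (minor N j))
  B j = sign j * (u j * det (minor N j))
  C j = sign j * (N zero j * E j)
  D j = sign j * (u j * E j)
  expand : ∀ s a b d e → s * ((a + b) * (d + e)) ≡ (s * (a * d) + s * (b * d)) + (s * (a * e) + s * (b * e))
  expand = solve-∀ ℚ-ring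
  regroup : ∀ a b c → (a + b) + (c + 0ℚ) ≡ a + (b + c)
  regroup = solve-∀ ℚ-ring
  swap-sums : ∀ (x : Fin (suc n) → ℚ) →
    Σ (λ j → sign j * (x j * E j)) ≡ Σ (λ i → Σ (λ j → sign j * (x j * F j i)))
  swap-sums x = trans (Σ-cong (λ j → *-distribˡ-Σ² (sign j) (x j) (F j))) (Σ-comm (λ j i → sign j * (x j * F j i)))
  ΣC : Σ C ≡ Σ (λ i → det (N [ suc i ]≔ u))
  ΣC = trans (swap-sums (N zero)) (Σ-cong (λ i → sym (det-[suc]≔ N i u)))
  -- the i-th summand is the determinant of N with rows 0 and i + 1 both replaced by u
  ΣD : Σ D ≡ 0ℚ
  ΣD = trans (swap-sums u) (Σ-zero λ i →
    trans (sym (det-[suc]≔ (N [ zero ]≔ u) i u))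
          (det-alternating (N [ zero ]≔ u [ suc i ]≔ u) {zero} {suc i} (λ ())
                           (sym (updateAt-updates (suc i) (N [ zero ]≔ u)))))

[]≔-cong : ∀ {n} (M : Mat n) r {u w : Fin n → ℚ} → (∀ j → u j ≡ w j) →
  ∀ i j → (M [ r ]≔ u) i j ≡ (M [ r ]≔ w) i j
[]≔-cong M r u≗w i j with i ≟ r
... | yes refl = trans (cong-app (updateAt-updates i M) j) (trans (u≗w j) (sym (cong-app (updateAt-updates i M) j)))
... | no i≢r   = trans (cong-app (updateAt-minimal i r M i≢r) j) (sym (cong-app (updateAt-minimal i r M i≢r) j))

det-[]≔-rowCombination : ∀ {n} (N : Mat n) t (y u : Fin n → ℚ) → (∀ j → Σ (λ k → y k * N k j) ≡ u j) →
  det (N [ t ]≔ u) ≡ y t * det N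
det-[]≔-rowCombination N t y u yN≡u = begin
  det (N [ t ]≔ u)
    ≡⟨ det-cong ([]≔-cong N t (sym ∘ yN≡u)) ⟩
  det (N [ t ]≔ (λ j → Σ (λ k → y k * N k j)))
    ≡⟨ det-[]≔-linear-Σ N t y N ⟩
  Σ (λ k → y k * det (N [ t ]≔ N k))
    ≡⟨ Σ-select _ t (λ k k≢t → trans (cong (y k *_) (repeated k k≢t)) (ℚ.*-zeroʳ (y k))) ⟩
  y t * det (N [ t ]≔ N t)
    ≡⟨ cong (y t *_) (det-cong-rows (updateAt-id-local t N refl)) ⟩
  y t * det N ∎
  where
  repeated : ∀ k → k ≢ t → det (N [ t ]≔ N k) ≡ 0ℚ
  repeated k k≢t = det-alternating (N [ t ]≔ N k) (k≢t ∘ sym)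
    (trans (updateAt-updates t N) (sym (updateAt-minimal k t N k≢t)))

matrix-determinant-lemma : ∀ {n} (N : Mat n) (y u : Fin n → ℚ) → (∀ j → Σ (λ k → y k * N k j) ≡ u j) →
  det (λ i j → N i j + u j) ≡ (1ℚ + Σ y) * det N
matrix-determinant-lemma N y u yN≡u = begin
  det (λ i j → N i j + u j)
    ≡⟨ det-add-to-rows N u ⟩
  det N + Σ (λ i → det (N [ i ]≔ u))
    ≡⟨ cong (det N +_) (Σ-cong (λ i → trans (det-[]≔-rowCombination N i y u yN≡u) (ℚ.*-comm (y i) (det N)))) ⟩
  det N + Σ (λ i → det N * y i)
    ≡⟨ cong (det N +_) (*-distribˡ-Σ (det N) y) ⟨
  det N + det N * Σ y
    ≡⟨ factor (det N) (Σ y) ⟩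
  (1ℚ + Σ y) * det N ∎
  where
  factor : ∀ d s → d + d * s ≡ (1ℚ + s) * d
  factor = solve-∀ ℚ-ring

det-neg : ∀ {n} (M : Mat n) → det (λ i j → - M i j) ≡ sgn n * det M
det-neg {zero}  M = refl
det-neg {suc n} M = begin
  Σ (λ j → sign j * (- M zero j * det (λ i k → - minor M j i k)))
    ≡⟨ Σ-cong (λ j → cong (λ d → sign j * (- M zero j * d)) (det-neg (minor M j))) ⟩
  Σ (λ j → sign j * (- M zero j * (sgn n * det (minor M j))))
    ≡⟨ Σ-cong (λ j → pull-sign (sign j) (M zero j) (sgn n) (det (minor M j))) ⟩
  Σ (λ j → (- sgn n) * (sign j * (M zero j * det (minor M j))))
    ≡⟨ *-distribˡ-Σ (- sgn n) (λ j → sign j * (M zero j * det (minor M j))) ⟨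
  (- sgn n) * det M ∎
  where
  pull-sign : ∀ s a σ d → s * (- a * (σ * d)) ≡ (- σ) * (s * (a * d))
  pull-sign = solve-∀ ℚ-ring

det-expand-column₀ : ∀ {n} (M : Mat (suc n)) →
  det M ≡ Σ (λ i → sign i * (M i zero * det (λ k l → M (punchIn i k) (suc l))))
det-expand-column₀ {zero}  M = refl
det-expand-column₀ {suc n} M = cong (sign {suc (suc n)} zero * (M zero zero * det (minor M zero)) +_) rest
  where
  Y : Fin (suc n) → Fin (suc n) → ℚ
  Y i j = det (λ k l → M (suc (punchIn i k)) (suc (punchIn j l)))
  exchange : ∀ si sj a b y → (- sj) * (a * (si * (b * y))) ≡ (- si) * (b * (sj * (a * y)))
  exchange = solve-∀ ℚ-ring
  -- Both sides expand to the sum over i, j ≥ 1 of ± M i 0 · M 0 j · Y i j.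
  rest : Σ (λ j → (- sign j) * (M zero (suc j) * det (minor M (suc j))))
       ≡ Σ (λ i → (- sign i) * (M (suc i) zero * Σ (λ j → sign j * (M zero (suc j) * Y i j))))
  rest = begin
    Σ (λ j → (- sign j) * (M zero (suc j) * det (minor M (suc j))))
      ≡⟨ Σ-cong (λ j → cong (λ d → (- sign j) * (M zero (suc j) * d)) (det-expand-column₀ (minor M (suc j)))) ⟩
    Σ (λ j → (- sign j) * (M zero (suc j) * Σ (λ i → sign i * (M (suc i) zero * Y i j))))
      ≡⟨ Σ-cong (λ j → *-distribˡ-Σ² (- sign j) (M zero (suc j)) (λ i → sign i * (M (suc i) zero * Y i j))) ⟩
    Σ (λ j → Σ (λ i → (- sign j) * (M zero (suc j) * (sign i * (M (suc i) zero * Y i j)))))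
      ≡⟨ Σ-cong (λ j → Σ-cong (λ i → exchange (sign i) (sign j) (M zero (suc j)) (M (suc i) zero) (Y i j))) ⟩
    Σ (λ j → Σ (λ i → (- sign i) * (M (suc i) zero * (sign j * (M zero (suc j) * Y i j)))))
      ≡⟨ Σ-comm (λ j i → (- sign i) * (M (suc i) zero * (sign j * (M zero (suc j) * Y i j)))) ⟩
    Σ (λ i → Σ (λ j → (- sign i) * (M (suc i) zero * (sign j * (M zero (suc j) * Y i j)))))
      ≡⟨ Σ-cong (λ i → *-distribˡ-Σ² (- sign i) (M (suc i) zero) (λ j → sign j * (M zero (suc j) * Y i j))) ⟨
    Σ (λ i → (- sign i) * (M (suc i) zero * Σ (λ j → sign j * (M zero (suc j) * Y i j)))) ∎

det-transpose : ∀ {n} (M : Mat n) → det (λ i j → M j i) ≡ det M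
det-transpose {zero}  M = refl
det-transpose {suc n} M = trans
  (Σ-cong (λ j → cong (λ d → sign j * (M j zero * d)) (det-transpose (λ k l → M (punchIn j k) (suc l)))))
  (sym (det-expand-column₀ M))

det-neg-add-ones : ∀ {n} (N B : Mat n) → (∀ i j → (B ⊗ N) i j ≡ I i j) →
  det (λ i j → - (N i j + 1ℚ)) ≡ sgn n * ((1ℚ + onesForm B) * det N)
det-neg-add-ones {n} N B BN≡I = begin
  det (λ i j → - (N i j + 1ℚ))       ≡⟨ det-neg (λ i j → N i j + 1ℚ) ⟩
  sgn n * det (λ i j → N i j + 1ℚ)   ≡⟨ cong (sgn n *_) (matrix-determinant-lemma N y (λ _ → 1ℚ) yN≡𝟏) ⟩
  sgn n * ((1ℚ + Σ y) * det N)       ≡⟨ cong (λ o → sgn n * ((1ℚ + o) * det N)) (Σ-comm (λ k i → B i k)) ⟩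
  sgn n * ((1ℚ + onesForm B) * det N) ∎
  where
  y : Fin n → ℚ
  y k = Σ (λ i → B i k)
  yN≡𝟏 : ∀ j → Σ (λ k → y k * N k j) ≡ 1ℚ
  yN≡𝟏 j = begin
    Σ (λ k → y k * N k j)                    ≡⟨ Σ-cong (λ k → *-distribʳ-Σ (N k j) (λ i → B i k)) ⟩
    Σ (λ k → Σ (λ i → B i k * N k j))        ≡⟨ Σ-comm (λ k i → B i k * N k j) ⟩
    Σ (λ i → (B ⊗ N) i j)                    ≡⟨ Σ-cong (λ i → BN≡I i j) ⟩
    Σ (λ i → I i j)                          ≡⟨ Σ-I-column j ⟩
    1ℚ                                       ∎

det-sub-ones : ∀ {n} (N : Mat n) s t → (∀ i → Σ (N i) ≡ s) → t * s ≡ 1ℚ →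
  det (λ i j → N i j - 1ℚ) ≡ (1ℚ - t * ℕ→ℚ n) * det N
det-sub-ones {n} N s t rowSum≡s ts≡1 = begin
  det (λ i j → N i j - 1ℚ)
    ≡⟨ det-transpose (λ i j → N i j - 1ℚ) ⟨
  det (λ i j → N j i - 1ℚ)
    ≡⟨ matrix-determinant-lemma (λ i j → N j i) (λ _ → - t) (λ _ → - 1ℚ) yNᵀ≡-𝟏 ⟩
  (1ℚ + Σ {n} (λ _ → - t)) * det (λ i j → N j i)
    ≡⟨ cong₂ (λ o d → (1ℚ + o) * d) (Σ-const {n} (- t)) (det-transpose N) ⟩
  (1ℚ + (- t) * ℕ→ℚ n) * det N
    ≡⟨ cong (_* det N) (neg-out 1ℚ t (ℕ→ℚ n)) ⟩
  (1ℚ - t * ℕ→ℚ n) * det N ∎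
  where
  neg-out : ∀ a t m → a + (- t) * m ≡ a - t * m
  neg-out = solve-∀ ℚ-ring
  yNᵀ≡-𝟏 : ∀ j → Σ (λ k → (- t) * N j k) ≡ - 1ℚ
  yNᵀ≡-𝟏 j = begin
    Σ (λ k → (- t) * N j k)   ≡⟨ *-distribˡ-Σ (- t) (N j) ⟨
    (- t) * Σ (N j)           ≡⟨ cong ((- t) *_) (rowSum≡s j) ⟩
    (- t) * s                 ≡⟨ ℚ.neg-distribˡ-* t s ⟨
    - (t * s)                 ≡⟨ cong -_ ts≡1 ⟩
    - 1ℚ                      ∎

-- Matrices of the complement

outDegree : ∀ {n} → Digraph n → Fin n → ℚ
outDegree D i = Σ (adjMat D i)

adjMat-complement : ∀ {n} (D : Digraph n) i j → adjMat (complement D) i j ≡ (1ℚ - I i j) - adjMat D i j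
adjMat-complement D i j with i ≟ j
... | yes refl rewrite loopless D i = refl
... | no _ with arc D i j
...   | true  = refl
...   | false = refl

outDegree-complement : ∀ {n} (D : Digraph n) i → outDegree (complement D) i ≡ (ℕ→ℚ n - 1ℚ) - outDegree D i
outDegree-complement {n} D i = begin
  Σ (adjMat (complement D) i)                    ≡⟨ Σ-cong (adjMat-complement D i) ⟩
  Σ (λ j → (1ℚ - I i j) - adjMat D i j)          ≡⟨ Σ-distrib-- (λ j → 1ℚ - I i j) (adjMat D i) ⟩
  Σ (λ j → 1ℚ - I i j) - outDegree D i           ≡⟨ cong (_- outDegree D i) (Σ-distrib-- (λ _ → 1ℚ) (I i)) ⟩
  (Σ {n} (λ _ → 1ℚ) - Σ (I i)) - outDegree D i   ≡⟨ cong₂ (λ a b → (a - b) - outDegree D i) count (Σ-I-row i) ⟩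
  (ℕ→ℚ n - 1ℚ) - outDegree D i                   ∎
  where
  count : Σ {n} (λ _ → 1ℚ) ≡ ℕ→ℚ n
  count = trans (Σ-const {n} 1ℚ) (ℚ.*-identityˡ (ℕ→ℚ n))

outDegMat-complement : ∀ {n} (D : Digraph n) i j →
  outDegMat (complement D) i j ≡ (ℕ→ℚ n - 1ℚ) * I i j - outDegMat D i j
outDegMat-complement {n} D i j with i ≟ j
... | yes refl = trans (outDegree-complement D i) (cong (_- outDegree D i) (sym (ℚ.*-identityʳ (ℕ→ℚ n - 1ℚ))))
... | no _     = sym (vanish (ℕ→ℚ n - 1ℚ))
  where
  vanish : ∀ c → c * 0ℚ - 0ℚ ≡ 0ℚ
  vanish = solve-∀ ℚ-ring

lapMat-rowSum : ∀ {n} (D : Digraph n) i → Σ (lapMat D i) ≡ 0ℚ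
lapMat-rowSum D i = begin
  Σ (lapMat D i)                           ≡⟨ Σ-distrib-- (outDegMat D i) (adjMat D i) ⟩
  Σ (outDegMat D i) - outDegree D i        ≡⟨ cong (_- outDegree D i) diagonal ⟩
  outDegree D i - outDegree D i            ≡⟨ ℚ.+-inverseʳ (outDegree D i) ⟩
  0ℚ                                       ∎
  where
  diagonal : Σ (outDegMat D i) ≡ outDegree D i
  diagonal = trans (Σ-select (outDegMat D i) i (λ j j≢i → cong pick (dec-false (i ≟ j) (j≢i ∘ sym))))
                   (cong pick (dec-true (i ≟ i) refl))
    where
    pick = if_then outDegree D i else 0ℚ

Σ-row-·I⊖ : ∀ {n} c (M : Mat n) i → Σ (((c ·I) ⊖ M) i) ≡ c - Σ (M i)
Σ-row-·I⊖ c M i = begin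
  Σ (λ j → c * I i j - M i j)   ≡⟨ Σ-distrib-- (λ j → c * I i j) (M i) ⟩
  Σ (λ j → c * I i j) - Σ (M i) ≡⟨ cong (_- Σ (M i)) (*-distribˡ-Σ c (I i)) ⟨
  c * Σ (I i) - Σ (M i)         ≡⟨ cong (λ o → c * o - Σ (M i)) (Σ-I-row i) ⟩
  c * 1ℚ - Σ (M i)              ≡⟨ cong (_- Σ (M i)) (ℚ.*-identityʳ c) ⟩
  c - Σ (M i)                   ∎

charPoly-adjMat-complement : ∀ {n} (D : Digraph n) x (B : Mat n) → IsInverse B (((- x - 1ℚ) ·I) ⊖ adjMat D) →
  charPoly (adjMat (complement D)) x ≡ sgn n * ((1ℚ + onesForm B) * charPoly (adjMat D) (- x - 1ℚ))
charPoly-adjMat-complement D x B (BN≡I , _) =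
  trans (det-cong entry) (det-neg-add-ones (((- x - 1ℚ) ·I) ⊖ adjMat D) B BN≡I)
  where
  rearrange : ∀ x e a → x * e - ((1ℚ - e) - a) ≡ - (((- x - 1ℚ) * e - a) + 1ℚ)
  rearrange = solve-∀ ℚ-ring
  entry : ∀ i j → ((x ·I) ⊖ adjMat (complement D)) i j ≡ - ((((- x - 1ℚ) ·I) ⊖ adjMat D) i j + 1ℚ)
  entry i j = trans (cong (λ q → x * I i j - q) (adjMat-complement D i j)) (rearrange x (I i j) (adjMat D i j))

charPoly-signlessLapMat-complement : ∀ {n} (D : Digraph n) x (B : Mat n) →
  IsInverse B (((ℕ→ℚ n - x - ℕ→ℚ 2) ·I) ⊖ signlessLapMat D) →
  charPoly (signlessLapMat (complement D)) x
    ≡ sgn n * ((1ℚ + onesForm B) * charPoly (signlessLapMat D) (ℕ→ℚ n - x - ℕ→ℚ 2))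
charPoly-signlessLapMat-complement {n} D x B (BN≡I , _) =
  trans (det-cong entry) (det-neg-add-ones (((ℕ→ℚ n - x - ℕ→ℚ 2) ·I) ⊖ signlessLapMat D) B BN≡I)
  where
  rearrange : ∀ m x e d a →
    x * e - (((m - 1ℚ) * e - d) + ((1ℚ - e) - a)) ≡ - (((m - x - (1ℚ + 1ℚ)) * e - (d + a)) + 1ℚ)
  rearrange = solve-∀ ℚ-ring
  entry : ∀ i j → ((x ·I) ⊖ signlessLapMat (complement D)) i j
                  ≡ - ((((ℕ→ℚ n - x - ℕ→ℚ 2) ·I) ⊖ signlessLapMat D) i j + 1ℚ)
  entry i j = trans (cong (λ q → x * I i j - q)
                          (cong₂ _+_ (outDegMat-complement D i j) (adjMat-complement D i j)))
                    (rearrange (ℕ→ℚ n) x (I i j) (outDegMat D i j) (adjMat D i j))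

charPoly-lapMat-complement : ∀ {n} (D : Digraph n) x (h : x - ℕ→ℚ n ≢ 0ℚ) →
  charPoly (lapMat (complement D)) x
    ≡ sgn n * ((_÷_ x (x - ℕ→ℚ n) {{≢-nonZero h}}) * charPoly (lapMat D) (ℕ→ℚ n - x))
charPoly-lapMat-complement {n} D x h = begin
  charPoly (lapMat (complement D)) x       ≡⟨ det-cong entry ⟩
  det (λ i j → - (N i j - 1ℚ))             ≡⟨ det-neg (λ i j → N i j - 1ℚ) ⟩
  sgn n * det (λ i j → N i j - 1ℚ)         ≡⟨ cong (sgn n *_) (det-sub-ones N (m - x) (- w) rowSum [-w]*[m-x]≡1) ⟩
  sgn n * ((1ℚ - (- w) * m) * det N)       ≡⟨ cong (λ c → sgn n * (c * det N)) factor ⟩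
  sgn n * ((x * w) * det N)                ∎
  where
  m = ℕ→ℚ n
  N = ((m - x) ·I) ⊖ lapMat D
  w = (1/ (x - m)) {{≢-nonZero h}}
  w*[x-m]≡1 : w * (x - m) ≡ 1ℚ
  w*[x-m]≡1 = ℚ.*-inverseˡ (x - m) {{≢-nonZero h}}
  [-w]*[m-x]≡1 : (- w) * (m - x) ≡ 1ℚ
  [-w]*[m-x]≡1 = trans (flip w m x) w*[x-m]≡1
    where
    flip : ∀ w m x → (- w) * (m - x) ≡ w * (x - m)
    flip = solve-∀ ℚ-ring
  factor : 1ℚ - (- w) * m ≡ x * w
  factor = trans (cong (λ o → o - (- w) * m) (sym w*[x-m]≡1)) (collect w m x)
    where
    collect : ∀ w m x → w * (x - m) - (- w) * m ≡ x * w
    collect = solve-∀ ℚ-ring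
  rowSum : ∀ i → Σ (N i) ≡ m - x
  rowSum i = begin
    Σ (N i)                         ≡⟨ Σ-row-·I⊖ (m - x) (lapMat D) i ⟩
    (m - x) - Σ (lapMat D i)        ≡⟨ cong (λ o → (m - x) - o) (lapMat-rowSum D i) ⟩
    (m - x) - 0ℚ                    ≡⟨ ℚ.+-identityʳ (m - x) ⟩
    m - x                           ∎
  rearrange : ∀ m x e d a → x * e - (((m - 1ℚ) * e - d) - ((1ℚ - e) - a)) ≡ - (((m - x) * e - (d - a)) - 1ℚ)
  rearrange = solve-∀ ℚ-ring
  entry : ∀ i j → ((x ·I) ⊖ lapMat (complement D)) i j ≡ - (N i j - 1ℚ)
  entry i j = trans (cong (λ q → x * I i j - q)
                          (cong₂ _-_ (outDegMat-complement D i j) (adjMat-complement D i j)))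
                    (rearrange m x (I i j) (outDegMat D i j) (adjMat D i j))

corollary2p4 : ∀ {n : ℕ} (D : Digraph n) →
    (∀ (x : ℚ) (B : Mat n) → IsInverse B (((- x - 1ℚ) ·I) ⊖ adjMat D) →
      charPoly (adjMat (complement D)) x
        ≡ sgn n * ((1ℚ + onesForm B) * charPoly (adjMat D) (- x - 1ℚ)))
  × (∀ (x : ℚ) (h : x - ℕ→ℚ n ≢ 0ℚ) →
      charPoly (lapMat (complement D)) x
        ≡ sgn n * ((_÷_ x (x - ℕ→ℚ n) {{≢-nonZero h}}) * charPoly (lapMat D) (ℕ→ℚ n - x)))
  × (∀ (x : ℚ) (B : Mat n) → IsInverse B (((ℕ→ℚ n - x - ℕ→ℚ 2) ·I) ⊖ signlessLapMat D) →
      charPoly (signlessLapMat (complement D)) x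
        ≡ sgn n * ((1ℚ + onesForm B) * charPoly (signlessLapMat D) (ℕ→ℚ n - x - ℕ→ℚ 2)))
corollary2p4 D =
  charPoly-adjMat-complement D , charPoly-lapMat-complement D , charPoly-signlessLapMat-complement D
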